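{- For every positive integer $n$, the number of marked rooted forests on $[n]$ is $n^n$; equivalently, \[ \sum_{F}\operatorname{mrec}(F)=n^n, \] where the sum runs over all rooted forests $F$ on $[n]$ and $\operatorname{mrec}(F)=\operatorname{rec}(T_1)\cdots\operatorname{rec}(T_j)$ for $F=\{T_1,\dots,T_j\}$, with $\operatorname{rec}(T_i)$ the number of records of $T_i$.
   Context: A rooted forest on $[n]=\{1,\dots,n\}$ is a set of labeled rooted trees whose vertex sets partition $[n]$. A vertex is a record if its label is the largest on the path from it to the root of its tree (inclusive). A marked rooted forest is a rooted forest together with a choice of one record in each of its trees. -}

module Defs where

open import Data.Nat using (ℕ; zero; suc; _+_; _*_; _≤ᵇ_)
open import Data.Fin using (Fin; toℕ)
open import Data.Fin.Properties using (_≟_)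
open import Data.Maybe using (Maybe; just; nothing)
open import Data.Bool using (Bool; true; false; _∧_; if_then_else_)
open import Data.List using (List; []; _∷_; map; concatMap; filter; length; allFin)
open import Data.Nat.ListAction using (sum; product)
open import Data.Vec using (Vec; lookup) renaming ([] to []v; _∷_ to _∷v_)
open import Relation.Nullary.Decidable using (⌊_⌋; Dec)
open import Relation.Binary.PropositionalEquality using (_≡_)

-- A rooted forest on [n] (vertices Fin n, label of v is toℕ v; the
-- order on labels is that of [n] shifted by one) is encoded by its
-- parent map: roots have parent 'nothing'.
ParentMap : ℕ → Set
ParentMap n = Fin n → Maybe (Fin n)

ancestor : ∀ {n} → ParentMap n → ℕ → Fin n → Maybe (Fin n)
ancestor p zero    v = just v
ancestor p (suc k) v with ancestor p k v
... | nothing = nothing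
... | just w  = p w

-- The parent map is a rooted forest iff it has no cycles, i.e. every
-- vertex reaches a root within n-1 steps, i.e. the n-th ancestor is undefined.
isForestᵇ : ∀ {n} → ParentMap n → Bool
isForestᵇ {n} p = allᵇ (allFin n)
  where
  allᵇ : List (Fin n) → Bool
  allᵇ []       = true
  allᵇ (v ∷ vs) = (case (ancestor p n v)) ∧ allᵇ vs
    where
    case : Maybe (Fin n) → Bool
    case nothing  = true
    case (just _) = false

-- root of the tree containing v (follow parents, fuel n suffices for forests)
rootOf : ∀ {n} → ParentMap n → Fin n → Fin n
rootOf {n} p v = go n v
  where
  go : ℕ → Fin n → Fin n
  go zero    w = w
  go (suc k) w with p w
  ... | nothing = w
  ... | just u  = go k u

-- v is a record: its label is ≥ every label on the path from v to its root
-- (the path consists of the ancestors 0..n-1 of v).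
isRecordᵇ : ∀ {n} → ParentMap n → Fin n → Bool
isRecordᵇ {n} p v = chk n
  where
  le : Maybe (Fin n) → Bool
  le nothing  = true
  le (just w) = toℕ w ≤ᵇ toℕ v
  chk : ℕ → Bool
  chk zero    = true
  chk (suc k) = le (ancestor p k v) ∧ chk k

isRootᵇ : ∀ {n} → ParentMap n → Fin n → Bool
isRootᵇ p r with p r
... | nothing = true
... | just _  = false

recTree : ∀ {n} → ParentMap n → Fin n → ℕ
recTree {n} p r =
  length (filter (λ v → Data.Bool._≟_ (isRecordᵇ p v ∧ ⌊ rootOf p v ≟ r ⌋) true) (allFin n))

mrec : ∀ {n} → ParentMap n → ℕ
mrec {n} p = product (map (recTree p) (filter (λ r → Data.Bool._≟_ (isRootᵇ p r) true) (allFin n)))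

allVecs : ∀ {A : Set} → (k : ℕ) → List A → List (Vec A k)
allVecs zero    xs = []v ∷ []
allVecs (suc k) xs = concatMap (λ x → map (x ∷v_) (allVecs k xs)) xs

allMaybeFin : (n : ℕ) → List (Maybe (Fin n))
allMaybeFin n = nothing ∷ map just (allFin n)

allParentMaps : (n : ℕ) → List (ParentMap n)
allParentMaps n = map lookup (allVecs n (allMaybeFin n))

rootedForests : (n : ℕ) → List (ParentMap n)
rootedForests n = filter (λ p → Data.Bool._≟_ (isForestᵇ p) true) (allParentMaps n)

markedForestCount : ℕ → ℕ
markedForestCount n = sum (map mrec (rootedForests n))

-- Marked rooted forests on [n] correspond bijectively to maps g : [n] → [n]. Send every non-root
-- vertex to its parent and every root to the marked record of its tree. From a mark m the map climbs
-- to the root r of its tree and then returns to m, so m lies on a cycle of g and, being a record, is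
-- the largest element of that cycle. Conversely g determines the forest: the roots are exactly the
-- vertices r lying on a cycle of g whose largest element is g r, and every other vertex v has parent
-- g v. Counting the pairs (forest, map encoding it) in two ways gives Σ_F mrec(F) = n ^ n.
module Submission where

open import Data.Bool using (Bool; true; false; T; _∧_; if_then_else_)
import Data.Bool as Bool
open import Data.Bool.ListAction using (all)
open import Data.Bool.Properties using (T-∧; T-≡)
open import Data.Fin as Fin using (Fin; zero; suc; toℕ; fromℕ<)
open import Data.Fin.Properties using (_≟_; all?; any?; ∀-cons-⇔; ≤-totalOrder; toℕ<n; toℕ-fromℕ<; pigeonhole)
  renaming (_≤?_ to _≤ᶠ?_; ≤-antisym to ≤ᶠ-antisym)
open import Data.List using (List; []; _∷_; _++_; map; filter; length; tabulate; allFin; concatMap; downFrom; upTo)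
import Data.List.Extrema
open import Data.List.Membership.Propositional using (_∈_)
open import Data.List.Membership.Propositional.Properties using (∈-allFin; ∈-downFrom⁺; ∈-downFrom⁻; ∈-upTo⁺)
open import Data.List.Properties using (map-tabulate; tabulate-cong; map-∘; map-cong; map-++; length-tabulate)
import Data.List.Relation.Unary.All as All
open import Data.List.Relation.Unary.All.Properties using (all⁺; all⁻; all-upTo)
open import Data.Maybe using (Maybe; just; nothing; maybe′; is-nothing; _>>=_)
open import Data.Maybe.Properties using (just-injective; ≡-dec)
open import Data.Nat
  using (ℕ; zero; suc; _+_; _*_; _∸_; _≤_; _<_; _≤ᵇ_; z≤n; s≤s; s≤s⁻¹; _≤′_; ≤′-refl; ≤′-step)
open import Data.Nat.DivMod using (_%_; _/_; m≡m%n+[m/n]*n; m%n<n)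
open import Data.Nat.ListAction using (sum; product)
open import Data.Nat.ListAction.Properties using (sum-++)
open import Data.Nat.Properties
  using (+-commutativeSemigroup; +-comm; +-suc; +-identityʳ; *-identityˡ; *-zeroʳ; *-distribˡ-+; *-distribʳ-+;
         ^-zeroˡ; ≤ᵇ⇒≤; ≤⇒≤ᵇ; ≤⇒≤′; <⇒≤; ≤-trans; ≤-<-trans; ≤∧≢⇒<; +-monoˡ-≤; m≤n+m; m∸n+n≡m; m+[n∸m]≡n;
         n<1+n)
open import Algebra.Properties.CommutativeSemigroup +-commutativeSemigroup using (interchange)
open import Data.Product using (∃; ∃₂; _×_; _,_; proj₁; proj₂)
open import Data.Product.Function.NonDependent.Propositional using (_×-⇔_)
open import Data.Sum using (_⊎_; inj₁; inj₂)
open import Data.Unit using (tt)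
open import Data.Vec using (Vec; lookup) renaming (_∷_ to _∷ᵛ_)
open import Function using (_∘_; _⇔_; mk⇔; Equivalence)
import Function.Properties.Equivalence as ⇔
open import Level using (0ℓ)
open import Relation.Binary.PropositionalEquality
  using (_≡_; refl; sym; trans; cong; cong₂; cong-app; subst; module ≡-Reasoning)
open import Relation.Nullary using (¬_; Dec; yes; no; does; contradiction)
open import Relation.Nullary.Decidable using (_×-dec_; ⌊_⌋; toWitness; fromWitness)
open import Relation.Unary using (Pred; Decidable)
open import Defs

open ≡-Reasoning

private
  variable
    A B : Set
    n : ℕ

module Iteration {A : Set} (g : A → A) where

  open import Function.Endo.Propositional A using (_^_; ^-homo)

  ^-+ : ∀ i j x → (g ^ (i + j)) x ≡ (g ^ i) ((g ^ j) x)
  ^-+ i j x = cong-app (^-homo g i j) x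

  module _ d {x} (period : (g ^ suc d) x ≡ x) where

    ^-*-period : ∀ q → (g ^ (q * suc d)) x ≡ x
    ^-*-period zero    = refl
    ^-*-period (suc q) = begin
      (g ^ (suc d + q * suc d)) x       ≡⟨ ^-+ (suc d) (q * suc d) x ⟩
      (g ^ suc d) ((g ^ (q * suc d)) x) ≡⟨ cong (g ^ suc d) (^-*-period q) ⟩
      (g ^ suc d) x                     ≡⟨ period ⟩
      x                                 ∎

    ^-mod : ∀ i → (g ^ i) x ≡ (g ^ (i % suc d)) x
    ^-mod i = begin
      (g ^ i) x                                         ≡⟨ cong (λ k → (g ^ k) x) (m≡m%n+[m/n]*n i (suc d)) ⟩
      (g ^ (i % suc d + (i / suc d) * suc d)) x         ≡⟨ ^-+ (i % suc d) _ x ⟩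
      (g ^ (i % suc d)) ((g ^ ((i / suc d) * suc d)) x) ≡⟨ cong (g ^ (i % suc d)) (^-*-period (i / suc d)) ⟩
      (g ^ (i % suc d)) x                               ∎

    periodic-all : ∀ {P : A → Set} → (∀ i → i ≤ d → P ((g ^ i) x)) → ∀ i → P ((g ^ i) x)
    periodic-all {P} P-upto i = subst P (sym (^-mod i)) (P-upto (i % suc d) (s≤s⁻¹ (m%n<n i (suc d))))

    periodic-returns : ∀ i → ∃ λ s → (g ^ s) ((g ^ i) x) ≡ x
    periodic-returns i = suc d ∸ j , (begin
      (g ^ (suc d ∸ j)) ((g ^ i) x) ≡⟨ cong (g ^ (suc d ∸ j)) (^-mod i) ⟩
      (g ^ (suc d ∸ j)) ((g ^ j) x) ≡⟨ sym (^-+ (suc d ∸ j) j x) ⟩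
      (g ^ (suc d ∸ j + j)) x       ≡⟨ cong (λ k → (g ^ k) x) (m∸n+n≡m (<⇒≤ (m%n<n i (suc d)))) ⟩
      (g ^ suc d) x                 ≡⟨ period ⟩
      x                             ∎)
      where
      j : ℕ
      j = i % suc d

  predecessor-unique : ∀ {x} a b → (g ^ suc a) x ≡ x → (g ^ suc b) x ≡ x → (g ^ a) x ≡ (g ^ b) x
  predecessor-unique {x} a b pa pb = begin
    (g ^ a) x                 ≡⟨ cong (g ^ a) (sym pb) ⟩
    (g ^ a) ((g ^ suc b) x)   ≡⟨ sym (^-+ a (suc b) x) ⟩
    (g ^ (a + suc b)) x       ≡⟨ cong (λ k → (g ^ k) x) (+-comm a (suc b)) ⟩
    (g ^ (suc b + a)) x       ≡⟨ cong (λ k → (g ^ k) x) (sym (+-suc b a)) ⟩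
    (g ^ (b + suc a)) x       ≡⟨ ^-+ b (suc a) x ⟩
    (g ^ b) ((g ^ suc a) x)   ≡⟨ cong (g ^ b) pa ⟩
    (g ^ b) x                 ∎

-- Ancestors, roots and records

IsForest : ParentMap n → Set
IsForest {n} p = ∀ v → ancestor p n v ≡ nothing

IsRecord : ParentMap n → Fin n → Set
IsRecord {n} p v = ∀ {k w} → k < n → ancestor p k v ≡ just w → w Fin.≤ v

module _ (p : ParentMap n) where

  ancestor-suc : ∀ k v → ancestor p (suc k) v ≡ (ancestor p k v >>= p)
  ancestor-suc k v with ancestor p k v
  ... | nothing = refl
  ... | just _  = refl

  ancestor-mono : ∀ {k l v} → ancestor p k v ≡ nothing → k ≤ l → ancestor p l v ≡ nothing
  ancestor-mono {k} {v = v} a k≤l = go (≤⇒≤′ k≤l)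
    where
    go : ∀ {l} → k ≤′ l → ancestor p l v ≡ nothing
    go ≤′-refl            = a
    go (≤′-step {l} k≤′l) = trans (ancestor-suc l v) (cong (_>>= p) (go k≤′l))

  ancestor-stops : ∀ {k v} → (∀ {w} → ancestor p k v ≡ just w → p w ≡ nothing) →
                   ancestor p (suc k) v ≡ nothing
  ancestor-stops {k} {v} stops with ancestor p k v
  ... | nothing = refl
  ... | just w  = stops refl

  ancestor-parent : ∀ {v u} → p v ≡ just u → ∀ k → ancestor p (suc k) v ≡ ancestor p k u
  ancestor-parent e zero    = e
  ancestor-parent {v} {u} e (suc k) = trans (ancestor-suc (suc k) v)
    (trans (cong (_>>= p) (ancestor-parent e k)) (sym (ancestor-suc k u)))

  walk : ℕ → Fin n → Fin n
  walk zero    v = v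
  walk (suc k) v = maybe′ (walk k) v (p v)

  walk-ancestor : ∀ k v → ∃ λ j → j ≤ k × ancestor p j v ≡ just (walk k v)
  walk-ancestor zero    v = 0 , z≤n , refl
  walk-ancestor (suc k) v with p v in e
  ... | nothing = 0 , z≤n , refl
  ... | just u with walk-ancestor k u
  ...   | j , j≤k , a = suc j , s≤s j≤k , trans (ancestor-parent e j) a

  walk-root : ∀ k v → ancestor p k v ≡ nothing → p (walk k v) ≡ nothing
  walk-root zero    v ()
  walk-root (suc k) v a with p v in e
  ... | nothing = e
  ... | just u  = walk-root k u (trans (sym (ancestor-parent e k)) a)

-- Defs.rootOf, Defs.isRecordᵇ and Defs.isForestᵇ recurse through local helpers (go, chk, allᵇ) that
-- cannot be named here. In each mutual block the helper is the left-hand side `_` of the second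
-- lemma, solved by unification at its use in the first; the `with` on the index (or on allFin n)
-- separates it from the fuel, which makes that unification problem a pattern.
mutual
  rootOf≡walk : (p : ParentMap n) (v : Fin n) → rootOf p v ≡ walk p n v
  rootOf≡walk {suc n} p v with suc n
  ... | _ with p v
  ...   | nothing = refl
  ...   | just u  = go≡walk p v n u

  go≡walk : (p : ParentMap n) (v : Fin n) (k : ℕ) (w : Fin n) → _ ≡ walk p k w
  go≡walk p v zero    w = refl
  go≡walk p v (suc k) w with p w
  ... | nothing = refl
  ... | just u  = go≡walk p v k u

mutual
  isRecordᵇ≡all : (p : ParentMap n) (v : Fin n) →
                  isRecordᵇ p v ≡ all (λ k → maybe′ (λ w → toℕ w ≤ᵇ toℕ v) true (ancestor p k v)) (downFrom n)
  isRecordᵇ≡all {suc n} p v with suc n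
  ... | _ with ancestor p n v
  ...   | nothing = chk≡all p v n
  ...   | just w  = cong ((toℕ w ≤ᵇ toℕ v) ∧_) (chk≡all p v n)

  chk≡all : (p : ParentMap n) (v : Fin n) (k : ℕ) →
            _ ≡ all (λ k → maybe′ (λ w → toℕ w ≤ᵇ toℕ v) true (ancestor p k v)) (downFrom k)
  chk≡all p v zero    = refl
  chk≡all p v (suc k) with ancestor p k v
  ... | nothing = chk≡all p v k
  ... | just w  = cong ((toℕ w ≤ᵇ toℕ v) ∧_) (chk≡all p v k)

mutual
  isForestᵇ≡all : (p : ParentMap n) → isForestᵇ p ≡ all (is-nothing ∘ ancestor p n) (allFin n)
  isForestᵇ≡all {n} p with allFin n
  ... | vs = allᵇ≡all p vs

  allᵇ≡all : (p : ParentMap n) (vs : List (Fin n)) → _ ≡ all (is-nothing ∘ ancestor p n) vs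
  allᵇ≡all p []       = refl
  allᵇ≡all {n} p (v ∷ vs) with ancestor p n v
  ... | nothing = allᵇ≡all p vs
  ... | just _  = refl

rootOf-ancestor : (p : ParentMap n) (v : Fin n) → ∃ λ j → j ≤ n × ancestor p j v ≡ just (rootOf p v)
rootOf-ancestor {n} p v rewrite rootOf≡walk p v = walk-ancestor p n v

rootOf-root : (p : ParentMap n) → IsForest p → ∀ v → p (rootOf p v) ≡ nothing
rootOf-root {n} p forest v rewrite rootOf≡walk p v = walk-root p n v (forest v)

T-all⇔ : (f : A → Bool) (xs : List A) → T (all f xs) ⇔ (∀ x → x ∈ xs → T (f x))
T-all⇔ f xs = mk⇔ (λ t _ → All.lookup (all⁺ f xs t)) (λ h → all⁻ f (All.tabulate (h _)))

T-is-nothing : (x : Maybe A) → T (is-nothing x) ⇔ x ≡ nothing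
T-is-nothing nothing  = mk⇔ (λ _ → refl) (λ _ → tt)
T-is-nothing (just _) = mk⇔ (λ ()) (λ ())

T-maybe-≤ᵇ : (v : Fin n) (x : Maybe (Fin n)) →
             T (maybe′ (λ w → toℕ w ≤ᵇ toℕ v) true x) ⇔ (∀ {w} → x ≡ just w → w Fin.≤ v)
T-maybe-≤ᵇ v nothing  = mk⇔ (λ _ ()) (λ _ → tt)
T-maybe-≤ᵇ v (just w) = mk⇔ (λ t → λ { refl → ≤ᵇ⇒≤ (toℕ w) (toℕ v) t }) (λ w≤v → ≤⇒≤ᵇ (w≤v refl))

isForestᵇ⇔IsForest : (p : ParentMap n) → T (isForestᵇ p) ⇔ IsForest p
isForestᵇ⇔IsForest {n} p = subst (λ b → T b ⇔ IsForest p) (sym (isForestᵇ≡all p)) (mk⇔ sound complete)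
  where
  rooted : Fin n → Bool
  rooted = is-nothing ∘ ancestor p n
  sound : T (all rooted (allFin n)) → IsForest p
  sound t v = Equivalence.to (T-is-nothing _) (Equivalence.to (T-all⇔ rooted (allFin n)) t v (∈-allFin v))
  complete : IsForest p → T (all rooted (allFin n))
  complete forest = Equivalence.from (T-all⇔ rooted (allFin n)) (λ v _ → Equivalence.from (T-is-nothing _) (forest v))

isRecordᵇ⇔IsRecord : (p : ParentMap n) (v : Fin n) → T (isRecordᵇ p v) ⇔ IsRecord p v
isRecordᵇ⇔IsRecord {n} p v = subst (λ b → T b ⇔ IsRecord p v) (sym (isRecordᵇ≡all p v)) (mk⇔ sound complete)
  where
  below : ℕ → Bool
  below k = maybe′ (λ w → toℕ w ≤ᵇ toℕ v) true (ancestor p k v)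
  sound : T (all below (downFrom n)) → IsRecord p v
  sound t k<n = Equivalence.to (T-maybe-≤ᵇ v _) (Equivalence.to (T-all⇔ below (downFrom n)) t _ (∈-downFrom⁺ k<n))
  complete : IsRecord p v → T (all below (downFrom n))
  complete isRecord = Equivalence.from (T-all⇔ below (downFrom n))
    (λ _ k∈ → Equivalence.from (T-maybe-≤ᵇ v _) (isRecord (∈-downFrom⁻ k∈)))

admissibleᵇ : ParentMap n → Fin n → Fin n → Bool
admissibleᵇ p r w with p r
... | nothing = isRecordᵇ p w ∧ ⌊ rootOf p w ≟ r ⌋
... | just u  = ⌊ w ≟ u ⌋

data Admissible (p : ParentMap n) (r : Fin n) : Fin n → Set where
  mark   : ∀ {w} → p r ≡ nothing → IsRecord p w → rootOf p w ≡ r → Admissible p r w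
  parent : ∀ {w} → p r ≡ just w → Admissible p r w

admissibleᵇ⇔Admissible : (p : ParentMap n) (r w : Fin n) → T (admissibleᵇ p r w) ⇔ Admissible p r w
admissibleᵇ⇔Admissible p r w with p r in pr
... | nothing = mk⇔ sound complete
  where
  sound : T (isRecordᵇ p w ∧ ⌊ rootOf p w ≟ r ⌋) → Admissible p r w
  sound t with Equivalence.to T-∧ t
  ... | isRecord , isRoot = mark pr (Equivalence.to (isRecordᵇ⇔IsRecord p w) isRecord) (toWitness isRoot)
  complete : Admissible p r w → T (isRecordᵇ p w ∧ ⌊ rootOf p w ≟ r ⌋)
  complete (mark _ isRecord isRoot) =
    Equivalence.from T-∧ (Equivalence.from (isRecordᵇ⇔IsRecord p w) isRecord , fromWitness isRoot)
  complete (parent pr′) with () ← trans (sym pr) pr′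
... | just u = mk⇔ (λ t → parent (trans pr (cong just (sym (toWitness t))))) complete
  where
  complete : Admissible p r w → T ⌊ w ≟ u ⌋
  complete (mark pr′ _ _) with () ← trans (sym pr) pr′
  complete (parent pr′)   = fromWitness (just-injective (trans (sym pr′) pr))

-- Decoding a map into a marked forest

argmax-upTo : (f : ℕ → Fin n) (d : ℕ) → ∃ λ c → c ≤ d × (∀ i → i ≤ d → f i Fin.≤ f c)
argmax-upTo {n} f d = c , argmax-all f {P = _≤ d} z≤n (All.map s≤s⁻¹ (all-upTo (suc d)))
                        , λ i i≤d → All.lookup (f[xs]≤f[argmax] {f = f} 0 (upTo (suc d))) (∈-upTo⁺ (s≤s i≤d))
  where
  open Data.List.Extrema (≤-totalOrder n) using (argmax; argmax-all; f[xs]≤f[argmax])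
  c : ℕ
  c = argmax f 0 (upTo (suc d))

module Code {n : ℕ} (g : Fin n → Fin n) where

  open import Function.Endo.Propositional (Fin n) using (_^_)
  open Iteration g

  -- Only the first n iterates are compared, which keeps CycleRoot decidable; by periodicity they
  -- bound the whole orbit (cycleRoot-max).
  OrbitMax : Fin n → Set
  OrbitMax x = ∀ (i : Fin n) → (g ^ toℕ i) x Fin.≤ x

  CycleRoot : Fin n → Set
  CycleRoot r = OrbitMax (g r) × ∃ λ (j : Fin n) → (g ^ toℕ j) (g r) ≡ r

  cycleRoot? : ∀ r → Dec (CycleRoot r)
  cycleRoot? r = all? (λ i → (g ^ toℕ i) (g r) ≤ᶠ? g r) ×-dec any? (λ j → (g ^ toℕ j) (g r) ≟ r)

  cycleRoot-intro : ∀ {r} j → j < n → (g ^ j) (g r) ≡ r →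
                    (∀ i → i ≤ j → (g ^ i) (g r) Fin.≤ g r) → CycleRoot r
  cycleRoot-intro {r} j j<n returns max =
    (λ i → periodic-all j (cong g returns) {Fin._≤ g r} max (toℕ i)) ,
    fromℕ< j<n , subst (λ k → (g ^ k) (g r) ≡ r) (sym (toℕ-fromℕ< j<n)) returns

  cycleRoot-max : ∀ {r} → CycleRoot r → ∀ i → (g ^ i) (g r) Fin.≤ g r
  cycleRoot-max {r} (max , j , returns) = periodic-all (toℕ j) (cong g returns) {Fin._≤ g r} max≤j
    where
    max≤j : ∀ i → i ≤ toℕ j → (g ^ i) (g r) Fin.≤ g r
    max≤j i i≤j = subst (λ k → (g ^ k) (g r) Fin.≤ g r) (toℕ-fromℕ< i<n) (max (fromℕ< i<n))
      where
      i<n : i < n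
      i<n = ≤-<-trans i≤j (toℕ<n j)

  -- g x and g r are both the largest element of the cycle through g r, and a point of a cycle has
  -- only one predecessor on it.
  cycleRoot-unique : ∀ {r x} → CycleRoot r → CycleRoot x → ∀ t → x ≡ (g ^ t) (g r) → x ≡ r
  cycleRoot-unique {r} {x} cr@(_ , j , returns) cx t x≡ = begin
    x                 ≡⟨ x≡ ⟩
    (g ^ t) (g r)     ≡⟨ predecessor-unique t (toℕ j) (trans (cong g (sym x≡)) gx≡gr) (cong g returns) ⟩
    (g ^ toℕ j) (g r) ≡⟨ returns ⟩
    r                 ∎
    where
    gr-returns : ∃ λ s → (g ^ s) (g x) ≡ g r
    gr-returns with periodic-returns (toℕ j) (cong g returns) (suc t)
    ... | s , back = s , trans (cong (λ y → (g ^ s) (g y)) x≡) back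
    gx≡gr : g x ≡ g r
    gx≡gr = ≤ᶠ-antisym (subst (Fin._≤ g r) (cong g (sym x≡)) (cycleRoot-max cr (suc t)))
                      (subst (Fin._≤ g x) (proj₂ gr-returns) (cycleRoot-max cx (proj₁ gr-returns)))

  orbit-enters-cycle : ∀ v → ∃₂ λ a d → a + suc d ≤ n × (g ^ suc d) ((g ^ a) v) ≡ (g ^ a) v
  orbit-enters-cycle v with pigeonhole (n<1+n n) (λ (i : Fin (suc n)) → (g ^ toℕ i) v)
  ... | i , j , i<j , same = toℕ i , d , subst (_≤ n) (sym a+sd≡b) (s≤s⁻¹ (toℕ<n j)) , period
    where
    d : ℕ
    d = toℕ j ∸ suc (toℕ i)
    a+sd≡b : toℕ i + suc d ≡ toℕ j
    a+sd≡b = trans (+-suc (toℕ i) d) (m+[n∸m]≡n i<j)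
    period : (g ^ suc d) ((g ^ toℕ i) v) ≡ (g ^ toℕ i) v
    period = begin
      (g ^ suc d) ((g ^ toℕ i) v) ≡⟨ sym (^-+ (suc d) (toℕ i) v) ⟩
      (g ^ (suc d + toℕ i)) v     ≡⟨ cong (λ k → (g ^ k) v) (trans (+-comm (suc d) (toℕ i)) a+sd≡b) ⟩
      (g ^ toℕ j) v               ≡⟨ sym same ⟩
      (g ^ toℕ i) v               ∎

  predecessor-of-max-cycleRoot : ∀ d {M} → d < n → (g ^ suc d) M ≡ M → (∀ i → (g ^ i) M Fin.≤ M) →
                                 CycleRoot ((g ^ d) M)
  predecessor-of-max-cycleRoot d d<n period max =
    cycleRoot-intro d d<n (cong (g ^ d) period) (λ i _ → subst (λ z → (g ^ i) z Fin.≤ z) (sym period) (max i))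

  cycle-cycleRoot : ∀ d {y} → d < n → (g ^ suc d) y ≡ y → ∃ λ e → e ≤ d × CycleRoot ((g ^ e) y)
  cycle-cycleRoot d {y} d<n period = fromMax (argmax-upTo (λ i → (g ^ i) y) d)
    where
    fromMax : (∃ λ c → c ≤ d × (∀ i → i ≤ d → (g ^ i) y Fin.≤ (g ^ c) y)) →
              ∃ λ e → e ≤ d × CycleRoot ((g ^ e) y)
    fromMax (c , _ , below-c) = (d + c) % suc d , s≤s⁻¹ (m%n<n (d + c) (suc d)) , subst CycleRoot r≡ cr
      where
      M-max : ∀ i → (g ^ i) ((g ^ c) y) Fin.≤ (g ^ c) y
      M-max i = subst (Fin._≤ (g ^ c) y) (^-+ i c y) (periodic-all d period {Fin._≤ (g ^ c) y} below-c (i + c))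
      M-period : (g ^ suc d) ((g ^ c) y) ≡ (g ^ c) y
      M-period = begin
        (g ^ suc d) ((g ^ c) y) ≡⟨ sym (^-+ (suc d) c y) ⟩
        (g ^ (suc d + c)) y     ≡⟨ cong (λ k → (g ^ k) y) (+-comm (suc d) c) ⟩
        (g ^ (c + suc d)) y     ≡⟨ ^-+ c (suc d) y ⟩
        (g ^ c) ((g ^ suc d) y) ≡⟨ cong (g ^ c) period ⟩
        (g ^ c) y               ∎
      cr : CycleRoot ((g ^ d) ((g ^ c) y))
      cr = predecessor-of-max-cycleRoot d d<n M-period M-max
      r≡ : (g ^ d) ((g ^ c) y) ≡ (g ^ ((d + c) % suc d)) y
      r≡ = trans (sym (^-+ d c y)) (^-mod d period (d + c))

  cycleRoot-reachable : ∀ v → ∃ λ k → k < n × CycleRoot ((g ^ k) v)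
  cycleRoot-reachable v =
    let a , d , a+sd≤n , period = orbit-enters-cycle v
        e , e≤d , cr = cycle-cycleRoot d (≤-trans (m≤n+m (suc d) a) a+sd≤n) period
    in e + a , ≤-trans (+-monoˡ-≤ a (s≤s e≤d)) (subst (_≤ n) (+-comm a (suc d)) a+sd≤n)
     , subst CycleRoot (sym (^-+ e a v)) cr

  Compatible : ParentMap n → Set
  Compatible p = ∀ x → p x ≡ nothing ⊎ p x ≡ just (g x)

  Encodes : ParentMap n → Set
  Encodes p = ∀ r → Admissible p r (g r)

  RootsAreCycleRoots : ParentMap n → Set
  RootsAreCycleRoots p = ∀ x → p x ≡ nothing → CycleRoot x

  module _ {p : ParentMap n} (compatible : Compatible p) where

    compatible-ancestor : ∀ k {v w} → ancestor p k v ≡ just w → w ≡ (g ^ k) v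
    compatible-ancestor zero    refl = refl
    compatible-ancestor (suc k) {v} {w} a with ancestor p k v in e
    ... | just u with compatible u
    ...   | inj₁ pu = contradiction (trans (sym a) pu) λ ()
    ...   | inj₂ pu = trans (just-injective (trans (sym a) pu)) (cong g (compatible-ancestor k e))

    compatible-ancestor-below : ∀ {i j v w} → ancestor p j v ≡ just w → i ≤ j → ancestor p i v ≡ just ((g ^ i) v)
    compatible-ancestor-below {i} {j} {v} a i≤j with ancestor p i v in e
    ... | nothing = contradiction (trans (sym a) (ancestor-mono p e i≤j)) λ ()
    ... | just _  = cong just (compatible-ancestor i e)

    root-cycleRoot : IsForest p → ∀ {r} → IsRecord p (g r) → rootOf p (g r) ≡ r → CycleRoot r
    root-cycleRoot forest {r} isRecord isRoot with rootOf-ancestor p (g r)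
    ... | j , j≤n , a = cycleRoot-intro j j<n (sym (compatible-ancestor j a′))
                          (λ i i≤j → isRecord (≤-<-trans i≤j j<n) (compatible-ancestor-below a′ i≤j))
      where
      a′ : ancestor p j (g r) ≡ just r
      a′ = trans a (cong just isRoot)
      j<n : j < n
      j<n = ≤∧≢⇒< j≤n (λ { refl → contradiction (trans (sym a′) (forest (g r))) λ () })

    rootOf-cycleRoot : IsForest p → RootsAreCycleRoots p → ∀ {r} → CycleRoot r → rootOf p (g r) ≡ r
    rootOf-cycleRoot forest roots {r} cr with rootOf-ancestor p (g r)
    ... | t , _ , a = cycleRoot-unique cr (roots _ (rootOf-root p forest (g r))) t (compatible-ancestor t a)

    nonroot-not-cycleRoot : IsForest p → RootsAreCycleRoots p → ∀ {r} → p r ≡ just (g r) → ¬ CycleRoot r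
    nonroot-not-cycleRoot forest roots {r} pr cr = contradiction (trans (sym pr) r-root) λ ()
      where
      r-root : p r ≡ nothing
      r-root = subst (λ x → p x ≡ nothing) (rootOf-cycleRoot forest roots cr) (rootOf-root p forest (g r))

  encodes⇒compatible : ∀ {p} → Encodes p → Compatible p
  encodes⇒compatible enc x with enc x
  ... | mark pr _ _ = inj₁ pr
  ... | parent pr   = inj₂ pr

  encodes⇒roots-cycleRoot : ∀ {p} → IsForest p → Encodes p → RootsAreCycleRoots p
  encodes⇒roots-cycleRoot forest enc x px with enc x
  ... | mark _ isRecord isRoot = root-cycleRoot (encodes⇒compatible enc) forest isRecord isRoot
  ... | parent px′             = contradiction (trans (sym px) px′) λ ()

  parentUnless : ∀ {r} → Dec (CycleRoot r) → Maybe (Fin n)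
  parentUnless     (yes _) = nothing
  parentUnless {r} (no _)  = just (g r)

  forestOf : ParentMap n
  forestOf r = parentUnless (cycleRoot? r)

  encodes⇒forestOf : ∀ {p} → IsForest p → Encodes p → ∀ r → p r ≡ forestOf r
  encodes⇒forestOf forest enc r with cycleRoot? r | enc r
  ... | yes _  | mark pr _ _ = pr
  ... | yes cr | parent pr   = contradiction cr
    (nonroot-not-cycleRoot (encodes⇒compatible enc) forest (encodes⇒roots-cycleRoot forest enc) pr)
  ... | no ¬cr | mark _ isRecord isRoot =
    contradiction (root-cycleRoot (encodes⇒compatible enc) forest isRecord isRoot) ¬cr
  ... | no _   | parent pr   = pr

  module Decoded {p : ParentMap n} (p≗forestOf : ∀ x → p x ≡ forestOf x) where

    cases : ∀ x → (p x ≡ nothing × CycleRoot x) ⊎ (p x ≡ just (g x) × ¬ CycleRoot x)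
    cases x with cycleRoot? x | p≗forestOf x
    ... | yes cx | px = inj₁ (px , cx)
    ... | no ¬cx | px = inj₂ (px , ¬cx)

    compatible : Compatible p
    compatible x with cases x
    ... | inj₁ (px , _) = inj₁ px
    ... | inj₂ (px , _) = inj₂ px

    roots-cycleRoot : RootsAreCycleRoots p
    roots-cycleRoot x px with cases x
    ... | inj₁ (_ , cx)   = cx
    ... | inj₂ (px′ , _)  = contradiction (trans (sym px) px′) λ ()

    cycleRoot-root : ∀ {x} → CycleRoot x → p x ≡ nothing
    cycleRoot-root {x} cx with cases x
    ... | inj₁ (px , _)  = px
    ... | inj₂ (_ , ¬cx) = contradiction cx ¬cx

    isForest : IsForest p
    isForest v = stopsBefore-n (cycleRoot-reachable v)
      where
      stopsBefore-n : (∃ λ k → k < n × CycleRoot ((g ^ k) v)) → ancestor p n v ≡ nothing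
      stopsBefore-n (k , k<n , cr) = ancestor-mono p (ancestor-stops p {k} λ a →
        subst (λ z → p z ≡ nothing) (sym (compatible-ancestor compatible k a)) (cycleRoot-root cr)) k<n

    encodes : Encodes p
    encodes r with cases r
    ... | inj₂ (pr , _)  = parent pr
    ... | inj₁ (pr , cr) = mark pr isRecord (rootOf-cycleRoot compatible isForest roots-cycleRoot cr)
      where
      isRecord : IsRecord p (g r)
      isRecord {k} _ a = subst (Fin._≤ g r) (sym (compatible-ancestor compatible k a)) (cycleRoot-max cr k)

  encodes⇔≗forestOf : ∀ {p} → (IsForest p × Encodes p) ⇔ (∀ r → p r ≡ forestOf r)
  encodes⇔≗forestOf = mk⇔ (λ (forest , enc) → encodes⇒forestOf forest enc)
                          (λ p≗ → Decoded.isForest p≗ , Decoded.encodes p≗)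

-- Indicators and finite sums

-- Imported only here: above, _^_ is the iteration of maps.
open import Data.Nat using (_^_)

𝟙 : Dec A → ℕ
𝟙 a? = if does a? then 1 else 0

𝟙-cong : A ⇔ B → (a? : Dec A) (b? : Dec B) → 𝟙 a? ≡ 𝟙 b?
𝟙-cong A⇔B (yes a) (no ¬b) = contradiction (Equivalence.to A⇔B a) ¬b
𝟙-cong A⇔B (no ¬a) (yes b) = contradiction (Equivalence.from A⇔B b) ¬a
𝟙-cong A⇔B (yes _) (yes _) = refl
𝟙-cong A⇔B (no _)  (no _)  = refl

𝟙-× : (a? : Dec A) (b? : Dec B) → 𝟙 a? * 𝟙 b? ≡ 𝟙 (a? ×-dec b?)
𝟙-× (yes _) (yes _) = refl
𝟙-× (yes _) (no _)  = refl
𝟙-× (no _)  _       = refl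

𝟙-⌊⌋ : (a? : Dec A) → 𝟙 (⌊ a? ⌋ Bool.≟ true) ≡ 𝟙 a?
𝟙-⌊⌋ (yes _) = refl
𝟙-⌊⌋ (no _)  = refl

∑ ∏ : ∀ {k} → (Fin k → ℕ) → ℕ
∑ f = sum (tabulate f)
∏ f = product (tabulate f)

sum-map-allFin : ∀ {k} (f : Fin k → ℕ) → sum (map f (allFin k)) ≡ ∑ f
sum-map-allFin f = cong sum (map-tabulate (λ i → i) f)

product-map-allFin : ∀ {k} (f : Fin k → ℕ) → product (map f (allFin k)) ≡ ∏ f
product-map-allFin f = cong product (map-tabulate (λ i → i) f)

∏-cong : ∀ {k} {f g : Fin k → ℕ} → (∀ i → f i ≡ g i) → ∏ f ≡ ∏ g
∏-cong f≗g = cong product (tabulate-cong f≗g)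

∏-const : ∀ k c → ∏ {k} (λ _ → c) ≡ c ^ k
∏-const zero    c = refl
∏-const (suc k) c = cong (c *_) (∏-const k c)

∑-const : ∀ k c → ∑ {k} (λ _ → c) ≡ k * c
∑-const zero    c = refl
∑-const (suc k) c = cong (c +_) (∑-const k c)

∑-δ : ∀ {k} (j : Fin k) → ∑ (λ i → 𝟙 (i ≟ j)) ≡ 1
∑-δ {suc k} zero    = cong suc (trans (∑-const k 0) (*-zeroʳ k))
∑-δ         (suc j) = ∑-δ j

∏-𝟙 : ∀ {k} {P : Pred (Fin k) 0ℓ} (P? : Decidable P) → ∏ (𝟙 ∘ P?) ≡ 𝟙 (all? P?)
∏-𝟙 {zero}  P? = 𝟙-cong (mk⇔ (λ _ ()) _) (yes tt) (all? P?)
∏-𝟙 {suc k} P? = begin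
  𝟙 (P? zero) * ∏ (𝟙 ∘ P? ∘ suc)      ≡⟨ cong (𝟙 (P? zero) *_) (∏-𝟙 (P? ∘ suc)) ⟩
  𝟙 (P? zero) * 𝟙 (all? (P? ∘ suc))   ≡⟨ 𝟙-× (P? zero) (all? (P? ∘ suc)) ⟩
  𝟙 (P? zero ×-dec all? (P? ∘ suc))    ≡⟨ 𝟙-cong ∀-cons-⇔ (P? zero ×-dec all? (P? ∘ suc)) (all? P?) ⟩
  𝟙 (all? P?)                          ∎


sum-filter : ∀ {P : Pred A 0ℓ} (P? : Decidable P) (h : A → ℕ) xs →
             sum (map h (filter P? xs)) ≡ sum (map (λ x → 𝟙 (P? x) * h x) xs)
sum-filter P? h [] = refl
sum-filter P? h (x ∷ xs) with does (P? x)
... | true  = cong₂ _+_ (sym (+-identityʳ (h x))) (sum-filter P? h xs)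
... | false = sum-filter P? h xs

length-filter : ∀ {P : Pred A 0ℓ} (P? : Decidable P) xs →
                length (filter P? xs) ≡ sum (map (𝟙 ∘ P?) xs)
length-filter P? [] = refl
length-filter P? (x ∷ xs) with does (P? x)
... | true  = cong suc (length-filter P? xs)
... | false = length-filter P? xs

product-filter : ∀ {P : Pred A 0ℓ} (P? : Decidable P) {h h′ : A → ℕ} →
                 (∀ x → P x → h x ≡ h′ x) → (∀ x → ¬ P x → h′ x ≡ 1) →
                 ∀ xs → product (map h (filter P? xs)) ≡ product (map h′ xs)
product-filter P? h≡h′ h′≡1 [] = refl
product-filter P? {h} {h′} h≡h′ h′≡1 (x ∷ xs) with P? x
... | yes px = cong₂ _*_ (h≡h′ x px) (product-filter P? h≡h′ h′≡1 xs)
... | no ¬px = begin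
  product (map h (filter P? xs)) ≡⟨ product-filter P? h≡h′ h′≡1 xs ⟩
  product (map h′ xs)            ≡⟨ sym (*-identityˡ _) ⟩
  1 * product (map h′ xs)        ≡⟨ cong (_* product (map h′ xs)) (sym (h′≡1 x ¬px)) ⟩
  h′ x * product (map h′ xs)     ∎

*-distribˡ-sum : ∀ c (f : A → ℕ) xs → c * sum (map f xs) ≡ sum (map (λ x → c * f x) xs)
*-distribˡ-sum c f []       = *-zeroʳ c
*-distribˡ-sum c f (x ∷ xs) = trans (*-distribˡ-+ c (f x) _) (cong (c * f x +_) (*-distribˡ-sum c f xs))

*-distribʳ-sum : ∀ c (f : A → ℕ) xs → sum (map f xs) * c ≡ sum (map (λ x → f x * c) xs)
*-distribʳ-sum c f []       = refl
*-distribʳ-sum c f (x ∷ xs) = trans (*-distribʳ-+ c (f x) _) (cong (f x * c +_) (*-distribʳ-sum c f xs))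

sum-map-+ : ∀ (f g : A → ℕ) xs → sum (map (λ x → f x + g x) xs) ≡ sum (map f xs) + sum (map g xs)
sum-map-+ f g []       = refl
sum-map-+ f g (x ∷ xs) = trans (cong (f x + g x +_) (sum-map-+ f g xs)) (interchange (f x) (g x) _ _)

sum-map-0 : ∀ (ys : List B) → sum (map (λ _ → 0) ys) ≡ 0
sum-map-0 []       = refl
sum-map-0 (_ ∷ ys) = sum-map-0 ys

sum-swap : ∀ (h : A → B → ℕ) xs ys →
           sum (map (λ x → sum (map (h x) ys)) xs) ≡ sum (map (λ y → sum (map (λ x → h x y) xs)) ys)
sum-swap h []       ys = sym (sum-map-0 ys)
sum-swap h (x ∷ xs) ys = trans (cong (sum (map (h x) ys) +_) (sum-swap h xs ys))
                               (sym (sum-map-+ (h x) _ ys))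

sum-concatMap : ∀ (f : B → ℕ) (h : A → List B) xs →
                sum (map f (concatMap h xs)) ≡ sum (map (λ x → sum (map f (h x))) xs)
sum-concatMap f h []       = refl
sum-concatMap f h (x ∷ xs) = begin
  sum (map f (h x ++ concatMap h xs))            ≡⟨ cong sum (map-++ f (h x) _) ⟩
  sum (map f (h x) ++ map f (concatMap h xs))    ≡⟨ sum-++ (map f (h x)) _ ⟩
  sum (map f (h x)) + sum (map f (concatMap h xs)) ≡⟨ cong (sum (map f (h x)) +_) (sum-concatMap f h xs) ⟩
  sum (map f (h x)) + sum (map (λ x → sum (map f (h x))) xs) ∎

∏-sum-distrib : ∀ k (a : Fin k → A → ℕ) xs →
                ∏ (λ i → sum (map (a i) xs)) ≡ sum (map (λ v → ∏ (λ i → a i (lookup v i))) (allVecs k xs))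
∏-sum-distrib zero    a xs = refl
∏-sum-distrib {A = A} (suc k) a xs = begin
  sum (map (a zero) xs) * ∏ (λ i → sum (map (a (suc i)) xs))
    ≡⟨ cong (sum (map (a zero) xs) *_) (∏-sum-distrib k (a ∘ suc) xs) ⟩
  sum (map (a zero) xs) * sum (map rest vs)
    ≡⟨ *-distribʳ-sum _ (a zero) xs ⟩
  sum (map (λ x → a zero x * sum (map rest vs)) xs)
    ≡⟨ cong sum (map-cong (λ x → trans (*-distribˡ-sum (a zero x) rest vs) (cong sum (map-∘ vs))) xs) ⟩
  sum (map (λ x → sum (map term (map (x ∷ᵛ_) vs))) xs)
    ≡⟨ sym (sum-concatMap term (λ x → map (x ∷ᵛ_) vs) xs) ⟩
  sum (map term (allVecs (suc k) xs))
    ∎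
  where
  vs : List (Vec A k)
  vs = allVecs k xs
  rest : Vec A k → ℕ
  rest v = ∏ (λ i → a (suc i) (lookup v i))
  term : Vec A (suc k) → ℕ
  term v = ∏ (λ i → a i (lookup v i))

sum-map-1 : (xs : List A) → sum (map (λ _ → 1) xs) ≡ length xs
sum-map-1 []       = refl
sum-map-1 (_ ∷ xs) = cong suc (sum-map-1 xs)

length-allVecs : ∀ k (xs : List A) → length (allVecs k xs) ≡ length xs ^ k
length-allVecs k xs = begin
  length (allVecs k xs)                             ≡⟨ sym (sum-map-1 (allVecs k xs)) ⟩
  sum (map (λ _ → 1) (allVecs k xs))                ≡⟨ cong sum (map-cong (λ _ → sym ∏1≡1) (allVecs k xs)) ⟩
  sum (map (λ _ → ∏ {k} (λ _ → 1)) (allVecs k xs))  ≡⟨ sym (∏-sum-distrib k (λ _ _ → 1) xs) ⟩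
  ∏ {k} (λ _ → sum (map (λ _ → 1) xs))              ≡⟨ ∏-const k _ ⟩
  sum (map (λ _ → 1) xs) ^ k                        ≡⟨ cong (_^ k) (sum-map-1 xs) ⟩
  length xs ^ k                                     ∎
  where
  ∏1≡1 : ∏ {k} (λ _ → 1) ≡ 1
  ∏1≡1 = trans (∏-const k 1) (^-zeroˡ k)

-- Double counting

_≟ᴹ_ : (x y : Maybe (Fin n)) → Dec (x ≡ y)
_≟ᴹ_ = ≡-dec _≟_

∀-⇔ : {P Q : A → Set} → (∀ x → P x ⇔ Q x) → (∀ x → P x) ⇔ (∀ x → Q x)
∀-⇔ P⇔Q = mk⇔ (λ p x → Equivalence.to (P⇔Q x) (p x)) (λ q x → Equivalence.from (P⇔Q x) (q x))

admissibleᵇ? : (p : ParentMap n) (r w : Fin n) → Dec (admissibleᵇ p r w ≡ true)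
admissibleᵇ? p r w = admissibleᵇ p r w Bool.≟ true

choices : ParentMap n → Fin n → ℕ
choices {n} p r = sum (map (𝟙 ∘ admissibleᵇ? p r) (allFin n))

mrec≡∏choices : (p : ParentMap n) → mrec p ≡ ∏ (choices p)
mrec≡∏choices {n} p = trans (product-filter (λ r → isRootᵇ p r Bool.≟ true) root nonroot (allFin n))
                            (product-map-allFin (choices p))
  where
  root : ∀ r → isRootᵇ p r ≡ true → recTree p r ≡ choices p r
  root r _ with p r
  ... | nothing = length-filter _ (allFin n)
  nonroot : ∀ r → ¬ isRootᵇ p r ≡ true → choices p r ≡ 1
  nonroot r nonRoot with p r
  ... | nothing = contradiction refl nonRoot
  ... | just u  = begin
    sum (map (λ w → 𝟙 (⌊ w ≟ u ⌋ Bool.≟ true)) (allFin n))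
      ≡⟨ cong sum (map-cong (λ w → 𝟙-⌊⌋ (w ≟ u)) (allFin n)) ⟩
    sum (map (λ w → 𝟙 (w ≟ u)) (allFin n))
      ≡⟨ sum-map-allFin (λ w → 𝟙 (w ≟ u)) ⟩
    ∑ (λ w → 𝟙 (w ≟ u))
      ≡⟨ ∑-δ u ⟩
    1 ∎

codes : (n : ℕ) → List (Vec (Fin n) n)
codes n = allVecs n (allFin n)

forest? : (p : ParentMap n) → Dec (isForestᵇ p ≡ true)
forest? p = isForestᵇ p Bool.≟ true

decodings : (Fin n → Fin n) → ℕ
decodings {n} g =
  sum (map (λ p → 𝟙 (forest? p) * ∏ (λ r → 𝟙 (admissibleᵇ? p r (g r)))) (allParentMaps n))

decoding-indicator : (g : Fin n → Fin n) (p : ParentMap n) →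
                     𝟙 (forest? p) * ∏ (λ r → 𝟙 (admissibleᵇ? p r (g r))) ≡
                     ∏ (λ r → 𝟙 (p r ≟ᴹ Code.forestOf g r))
decoding-indicator {n} g p = begin
  𝟙 (forest? p) * ∏ (𝟙 ∘ admissible?)  ≡⟨ cong (𝟙 (forest? p) *_) (∏-𝟙 admissible?) ⟩
  𝟙 (forest? p) * 𝟙 (all? admissible?)  ≡⟨ 𝟙-× (forest? p) (all? admissible?) ⟩
  𝟙 (forest? p ×-dec all? admissible?)  ≡⟨ 𝟙-cong checks⇔decoded (forest? p ×-dec all? admissible?) (all? decoded?) ⟩
  𝟙 (all? decoded?)                     ≡⟨ sym (∏-𝟙 decoded?) ⟩
  ∏ (𝟙 ∘ decoded?)                      ∎
  where
  open Code g using (forestOf; encodes⇔≗forestOf)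
  admissible? : (r : Fin n) → Dec (admissibleᵇ p r (g r) ≡ true)
  admissible? r = admissibleᵇ? p r (g r)
  decoded? : (r : Fin n) → Dec (p r ≡ forestOf r)
  decoded? r = p r ≟ᴹ forestOf r
  checks⇔decoded : (isForestᵇ p ≡ true × (∀ r → admissibleᵇ p r (g r) ≡ true)) ⇔ (∀ r → p r ≡ forestOf r)
  checks⇔decoded = ⇔.trans (⇔.trans (⇔.sym T-≡) (isForestᵇ⇔IsForest p)
                            ×-⇔ ∀-⇔ (λ r → ⇔.trans (⇔.sym T-≡) (admissibleᵇ⇔Admissible p r (g r))))
                           encodes⇔≗forestOf

allMaybeFin-δ : (y : Maybe (Fin n)) → sum (map (λ x → 𝟙 (x ≟ᴹ y)) (allMaybeFin n)) ≡ 1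
allMaybeFin-δ {n} y = begin
  𝟙 (nothing ≟ᴹ y) + sum (map (λ x → 𝟙 (x ≟ᴹ y)) (map just (allFin n)))
    ≡⟨ cong (𝟙 (nothing ≟ᴹ y) +_) (cong sum (sym (map-∘ (allFin n)))) ⟩
  𝟙 (nothing ≟ᴹ y) + sum (map (λ i → 𝟙 (just i ≟ᴹ y)) (allFin n))
    ≡⟨ cong (𝟙 (nothing ≟ᴹ y) +_) (sum-map-allFin (λ i → 𝟙 (just i ≟ᴹ y))) ⟩
  𝟙 (nothing ≟ᴹ y) + ∑ (λ i → 𝟙 (just i ≟ᴹ y))
    ≡⟨ just-or-nothing y ⟩
  1 ∎
  where
  just-or-nothing : (z : Maybe (Fin n)) → 𝟙 (nothing ≟ᴹ z) + ∑ (λ i → 𝟙 (just i ≟ᴹ z)) ≡ 1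
  just-or-nothing nothing  = cong suc (trans (∑-const n 0) (*-zeroʳ n))
  just-or-nothing (just j) = ∑-δ j

decodings≡1 : (g : Fin n → Fin n) → decodings g ≡ 1
decodings≡1 {n} g = begin
  decodings g
    ≡⟨ cong sum (map-cong (decoding-indicator g) (allParentMaps n)) ⟩
  sum (map (λ p → ∏ (λ r → 𝟙 (p r ≟ᴹ forestOf r))) (map lookup (allVecs n (allMaybeFin n))))
    ≡⟨ cong sum (sym (map-∘ (allVecs n (allMaybeFin n)))) ⟩
  sum (map (λ v → ∏ (λ r → 𝟙 (lookup v r ≟ᴹ forestOf r))) (allVecs n (allMaybeFin n)))
    ≡⟨ sym (∏-sum-distrib n (λ r x → 𝟙 (x ≟ᴹ forestOf r)) (allMaybeFin n)) ⟩
  ∏ (λ r → sum (map (λ x → 𝟙 (x ≟ᴹ forestOf r)) (allMaybeFin n)))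
    ≡⟨ ∏-cong (λ r → allMaybeFin-δ (forestOf r)) ⟩
  ∏ {n} (λ _ → 1)
    ≡⟨ ∏-const n 1 ⟩
  1 ^ n
    ≡⟨ ^-zeroˡ n ⟩
  1 ∎
  where
  open Code g using (forestOf)

markedForestCount≡sum-decodings : ∀ n →
                                  markedForestCount n ≡ sum (map (λ v → decodings (lookup v)) (codes n))
markedForestCount≡sum-decodings n = begin
  markedForestCount n
    ≡⟨ sum-filter forest? mrec (allParentMaps n) ⟩
  sum (map (λ p → 𝟙 (forest? p) * mrec p) (allParentMaps n))
    ≡⟨ cong sum (map-cong expand (allParentMaps n)) ⟩
  sum (map (λ p → sum (map (λ v → 𝟙 (forest? p) * weight p v) (codes n))) (allParentMaps n))
    ≡⟨ sum-swap (λ p v → 𝟙 (forest? p) * weight p v) (allParentMaps n) (codes n) ⟩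
  sum (map (λ v → decodings (lookup v)) (codes n)) ∎
  where
  weight : ParentMap n → Vec (Fin n) n → ℕ
  weight p v = ∏ (λ r → 𝟙 (admissibleᵇ? p r (lookup v r)))
  expand : ∀ p → 𝟙 (forest? p) * mrec p ≡ sum (map (λ v → 𝟙 (forest? p) * weight p v) (codes n))
  expand p = begin
    𝟙 (forest? p) * mrec p                          ≡⟨ cong (𝟙 (forest? p) *_) (mrec≡∏choices p) ⟩
    𝟙 (forest? p) * ∏ (choices p)                   ≡⟨ cong (𝟙 (forest? p) *_) (∏-sum-distrib n _ (allFin n)) ⟩
    𝟙 (forest? p) * sum (map (weight p) (codes n))  ≡⟨ *-distribˡ-sum (𝟙 (forest? p)) (weight p) (codes n) ⟩
    sum (map (λ v → 𝟙 (forest? p) * weight p v) (codes n)) ∎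

corollary4p7 : (n : ℕ) → 1 ≤ n → markedForestCount n ≡ n ^ n
corollary4p7 n _ = begin
  markedForestCount n                               ≡⟨ markedForestCount≡sum-decodings n ⟩
  sum (map (λ v → decodings (lookup v)) (codes n))  ≡⟨ cong sum (map-cong (decodings≡1 ∘ lookup) (codes n)) ⟩
  sum (map (λ _ → 1) (codes n))                     ≡⟨ sum-map-1 (codes n) ⟩
  length (codes n)                                  ≡⟨ length-allVecs n (allFin n) ⟩
  length (allFin n) ^ n                             ≡⟨ cong (_^ n) (length-tabulate (λ i → i)) ⟩
  n ^ n                                             ∎
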